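{- Let $q$ be an odd prime power. Suppose there exist a positive integer $h$, permutations $\rho,\tau$ of $\{1,\dots,h\}$, a vector $\sigma\in\{\pm1\}^h$ and nonzero elements $r,m_1,\dots,m_h,v_1,\dots,v_h\in\mathbb{F}_q^*$ such that for $1\le i\le h$ $$\sigma(i)m_iv_i=rv_{\rho(i)},\qquad (m_i-1)v_i=(r-1)v_{\tau(i)},$$ and $$0\neq (m_1-r)\prod_{i=2}^h(m_1-m_i)\prod_{1\le i<j\le h}(v_i^2-v_j^2).$$ Then there exists an orthomorphism $\phi\in\mathscr{D}_{(q-1)/2}(q)$.
   Context: Let $\mathbb{F}_q$ be the finite field of order $q$. An orthomorphism is a permutation $\theta$ of $\mathbb{F}_q$ such that $x\mapsto\theta(x)-x$ is also a permutation. For $k\mid(q-1)$, fix a generator $g$ of $\mathbb{F}_q^*$ and let $C_{k,i}=\{g^j: j\equiv i\pmod k\}$, $0\le i<k$ (cyclotomy classes of index $k$). A cyclotomic map of index $k$ with multipliers $[a_0,\dots,a_{k-1}]$ is $\theta(0)=0$, $\theta(x)=a_ix$ for $x\in C_{k,i}$. $\mathscr{C}_k(q)$ is the set of orthomorphisms that are cyclotomic maps of index $k$, and $\mathscr{D}_k(q)=\mathscr{C}_k(q)\setminus\bigcup_{\ell<k,\ \ell\mid(q-1)}\mathscr{C}_\ell(q)$ (orthomorphisms of least index $k$). For $q$ odd, the cyclotomy classes of index $(q-1)/2$ are the sets $\{x,-x\}$, $x\in\mathbb{F}_q^*$. -}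

module Defs where

open import Data.Nat as ℕ using (ℕ; zero; _<_; _∸_)
import Data.Nat.Divisibility as ℕD
open import Data.Nat.Primality using (Prime)
open import Data.Fin using (Fin; toℕ)
open import Data.List using (List; foldr)
open import Data.Product using (Σ; ∃; _×_; _,_)
open import Data.Sign using (Sign)
open import Function.Bundles using (_↔_)
open import Function.Definitions using (Bijective)
open import Algebra.Structures using (IsCommutativeRing)
open import Relation.Binary.PropositionalEquality using (_≡_; _≢_)
open import Relation.Binary.Definitions using (DecidableEquality)
open import Relation.Nullary using (¬_)

IsPrimePower : ℕ → Set
IsPrimePower q = Σ ℕ λ p → Σ ℕ λ n → Prime p × 0 < n × q ≡ p ℕ.^ n

record FiniteField (q : ℕ) : Set₁ where
  infixl 7 _*_
  infixl 6 _+_ _-_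
  field
    Carrier   : Set
    _+_ _*_   : Carrier → Carrier → Carrier
    -_        : Carrier → Carrier
    0# 1#     : Carrier
    isCommutativeRing : IsCommutativeRing _≡_ _+_ _*_ -_ 0# 1#
    1≢0       : 1# ≢ 0#
    inverse   : ∀ x → x ≢ 0# → ∃ λ y → x * y ≡ 1#
    _≟_       : DecidableEquality Carrier
    enum      : Carrier ↔ Fin q

  _-_ : Carrier → Carrier → Carrier
  x - y = x + (- y)

  _^_ : Carrier → ℕ → Carrier
  x ^ zero    = 1#
  x ^ ℕ.suc n = x * (x ^ n)

  prod : List Carrier → Carrier
  prod = foldr _*_ 1#

  signF : Sign → Carrier
  signF Sign.+ = 1#
  signF Sign.- = - 1#

  IsGenerator : Carrier → Set
  IsGenerator g = g ≢ 0# × (∀ x → x ≢ 0# → ∃ λ j → g ^ j ≡ x)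

  IsOrthomorphism : (Carrier → Carrier) → Set
  IsOrthomorphism θ = Bijective _≡_ _≡_ θ × Bijective _≡_ _≡_ (λ x → θ x - x)

  -- cyclotomic map of index k w.r.t. generator g with multipliers a_0..a_{k-1}:
  -- θ(0) = 0 and θ(x) = a_i x for x ∈ C_{k,i} = { g^j : j ≡ i mod k },
  -- every such j being written uniquely as i + t k with i < k.
  IsCyclotomicMap : Carrier → (k : ℕ) → (Carrier → Carrier) → Set
  IsCyclotomicMap g k θ =
    Σ (Fin k → Carrier) λ a →
      θ 0# ≡ 0# ×
      (∀ (i : Fin k) (t : ℕ) → θ (g ^ (toℕ i ℕ.+ t ℕ.* k)) ≡ a i * g ^ (toℕ i ℕ.+ t ℕ.* k))

  InC : Carrier → ℕ → (Carrier → Carrier) → Set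
  InC g k θ = k ℕD.∣ (q ∸ 1) × IsOrthomorphism θ × IsCyclotomicMap g k θ

  InD : Carrier → ℕ → (Carrier → Carrier) → Set
  InD g k θ = InC g k θ × (∀ ℓ → ℓ < k → ℓ ℕD.∣ (q ∸ 1) → ¬ InC g ℓ θ)

module Submission where

-- Let φ multiply the class {± v i} by m i and every other x by r. As the v i ² are distinct,
-- φ maps each class {± v i} onto r times the class of v (ρ i) and φ - id maps it onto (r - 1)
-- times the class of v (τ i), while off these classes φ and φ - id are multiplications by
-- r ≠ 0 and r - 1 ≠ 0; so both are injective, hence permutations of the finite field. φ only
-- depends on x ², which multiplication by g ^ ((q - 1) / 2) = ± 1 preserves, so φ is
-- cyclotomic of index (q - 1) / 2. If it were cyclotomic of a smaller index ℓ, then v₁ and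
-- v₁ g ^ ℓ would get the same multiplier m₁; as m₁ differs from r and from the other m i, this
-- puts v₁ g ^ ℓ into the class {± v₁}, so g ^ (2 ℓ) = 1 with 0 < 2 ℓ < q - 1.

open import Defs
open import Data.Nat as ℕ using (ℕ; _∸_; _<_; _≤_; z≤n; zero; suc)
open import Data.Nat.DivMod using (_/_; _%_; m≡m%n+[m/n]*n; m%n<n; m*[n/m]≡n)
import Data.Nat.Divisibility as ℕD
import Data.Nat.Properties as ℕP
open import Data.Fin using (Fin; toℕ; zero; suc; punchIn; punchOut; fromℕ<)
import Data.Fin as Fin
open import Data.Fin.Properties
  using ( any?; pigeonhole; injective⇒≤; punchOut-injective; punchIn-injective; punchInᵢ≢i
        ; toℕ-fromℕ<; toℕ<n; <-cmp; ¬Fin0)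
open import Data.Fin.Permutation using (Permutation′; _⟨$⟩ʳ_)
open import Data.List using (map; concatMap; filterᵇ; allFin)
open import Data.List.Membership.Propositional using (_∈_; lose)
open import Data.List.Membership.Propositional.Properties
  using (∈-concatMap⁺; ∈-map⁺; ∈-filter⁺; ∈-allFin)
open import Data.List.Relation.Unary.Any using (here; there)
open import Data.Product using (Σ; ∃; ∃₂; _×_; _,_; proj₁; proj₂)
open import Data.Sum using (_⊎_; inj₁; inj₂)
open import Data.Sign using (Sign)
open import Data.Empty using (⊥-elim)
open import Function using (_∘_)
open import Function.Bundles using (_↔_; Inverse; Injection)
open import Function.Definitions using (Injective; Surjective; StrictlySurjective; Bijective)
open import Function.Consequences.Propositional using (strictlySurjective⇒surjective)
open import Function.Construct.Composition using () renaming (injective to ∘-injective)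
open import Function.Properties.Inverse using (↔⇒↣; ↔-sym)
open import Algebra.Bundles using (CommutativeRing)
import Algebra.Properties.CommutativeSemigroup as CommutativeSemigroupProperties
open import Algebra.Structures using (IsCommutativeRing)
open import Relation.Binary.Definitions using (DecidableEquality; tri<; tri≈; tri>)
open import Relation.Binary.PropositionalEquality
open import Relation.Nullary using (¬_; Dec; yes; no; contradiction)
open import Relation.Nullary.Decidable.Core using (T?)

module ℕ+ = CommutativeSemigroupProperties ℕP.+-commutativeSemigroup

↔-to-injective : ∀ {a b} {A : Set a} {B : Set b} (E : A ↔ B) → Injective _≡_ _≡_ (Inverse.to E)
↔-to-injective E = Injection.injective (↔⇒↣ E)

Fin-injective⇒strictlySurjective : ∀ {n} {f : Fin n → Fin n} →
  Injective _≡_ _≡_ f → StrictlySurjective _≡_ f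
Fin-injective⇒strictlySurjective {suc n} {f} f-inj y with any? (λ x → f x Fin.≟ y)
... | yes hit = hit
... | no miss = contradiction (injective⇒≤ avoid-y-injective) ℕP.1+n≰n
  where
  y≢f : ∀ x → y ≢ f x
  y≢f x y≡fx = miss (x , sym y≡fx)

  avoid-y-injective : Injective _≡_ _≡_ (λ x → punchOut (y≢f x))
  avoid-y-injective {a} {b} = f-inj ∘ punchOut-injective (y≢f a) (y≢f b)

↔Fin-injective⇒surjective : ∀ {a} {A : Set a} {n} → A ↔ Fin n → {f : A → A} →
  Injective _≡_ _≡_ f → Surjective _≡_ _≡_ f
↔Fin-injective⇒surjective E {f} f-inj = strictlySurjective⇒surjective preimage
  where
  open Inverse E

  to∘f∘from-injective : Injective _≡_ _≡_ (to ∘ f ∘ from)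
  to∘f∘from-injective =
    ∘-injective _≡_ _≡_ _≡_ (↔-to-injective (↔-sym E))
      (∘-injective _≡_ _≡_ _≡_ f-inj (↔-to-injective E))

  preimage : StrictlySurjective _≡_ f
  preimage y with Fin-injective⇒strictlySurjective to∘f∘from-injective (to y)
  ... | x , eq = from x , ↔-to-injective E eq

module _ {a} {A : Set a} (_≟_ : DecidableEquality A) {h} (key : Fin h → A) where

  opaque
    lookupOr : ∀ {b} {B : Set b} → (Fin h → B) → B → A → B
    lookupOr val default y with any? (λ i → y ≟ key i)
    ... | yes (i , _) = val i
    ... | no _        = default

    lookupOr-key : ∀ {b} {B : Set b} → Injective _≡_ _≡_ key → ∀ (val : Fin h → B) default i →
      lookupOr val default (key i) ≡ val i
    lookupOr-key key-inj val default i with any? (λ j → key i ≟ key j)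
    ... | yes (j , kᵢ≡kⱼ) = cong val (key-inj (sym kᵢ≡kⱼ))
    ... | no miss         = contradiction (i , refl) miss

    lookupOr-default : ∀ {b} {B : Set b} (val : Fin h → B) default {y} → ¬ (∃ λ i → y ≡ key i) →
      lookupOr val default y ≡ default
    lookupOr-default val default {y} y∉ with any? (λ i → y ≟ key i)
    ... | yes hit = contradiction hit y∉
    ... | no _    = refl

    lookupOr-map : ∀ {b c} {B : Set b} {C : Set c} (f : B → C) (val : Fin h → B) default y →
      lookupOr (f ∘ val) (f default) y ≡ f (lookupOr val default y)
    lookupOr-map f val default y with any? (λ i → y ≟ key i)
    ... | yes _ = refl
    ... | no _  = refl

module FieldProperties {q : ℕ} (F : FiniteField q) where
  open FiniteField F
  open IsCommutativeRing isCommutativeRing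
    using (*-comm; *-assoc; zeroˡ; zeroʳ; *-identityˡ; *-identityʳ)

  ring : CommutativeRing _ _
  ring = record { isCommutativeRing = isCommutativeRing }

  open import Algebra.Properties.Ring (CommutativeRing.ring ring)
    using (x∙y⁻¹≈ε⇒x≈y; x≈y⇒x∙y⁻¹≈ε; x[y-z]≈xy-xz; [y-z]x≈yx-zx; -‿distribˡ-*; -‿involutive)
  open CommutativeSemigroupProperties (CommutativeRing.*-commutativeSemigroup ring) using (interchange)

  x-y≡0⇒x≡y : ∀ {x y} → x - y ≡ 0# → x ≡ y
  x-y≡0⇒x≡y {x} {y} = x∙y⁻¹≈ε⇒x≈y x y

  x≡y⇒x-y≡0 : ∀ {x y} → x ≡ y → x - y ≡ 0#
  x≡y⇒x-y≡0 = x≈y⇒x∙y⁻¹≈ε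

  x*y≡0⇒x≡0⊎y≡0 : ∀ {x y} → x * y ≡ 0# → x ≡ 0# ⊎ y ≡ 0#
  x*y≡0⇒x≡0⊎y≡0 {x} {y} xy≡0 with x ≟ 0#
  ... | yes x≡0 = inj₁ x≡0
  ... | no x≢0 with inverse x x≢0
  ... | x⁻¹ , xx⁻¹≡1 = inj₂ (begin
    y                ≡⟨ sym (*-identityˡ y) ⟩
    1# * y           ≡⟨ cong (_* y) (trans (sym xx⁻¹≡1) (*-comm x x⁻¹)) ⟩
    x⁻¹ * x * y      ≡⟨ *-assoc x⁻¹ x y ⟩
    x⁻¹ * (x * y)    ≡⟨ cong (x⁻¹ *_) xy≡0 ⟩
    x⁻¹ * 0#         ≡⟨ zeroʳ x⁻¹ ⟩
    0#               ∎)
    where open ≡-Reasoning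

  x*y≢0 : ∀ {x y} → x ≢ 0# → y ≢ 0# → x * y ≢ 0#
  x*y≢0 x≢0 y≢0 xy≡0 with x*y≡0⇒x≡0⊎y≡0 xy≡0
  ... | inj₁ x≡0 = x≢0 x≡0
  ... | inj₂ y≡0 = y≢0 y≡0

  x*y≢0⇒x≢0 : ∀ {x y} → x * y ≢ 0# → x ≢ 0#
  x*y≢0⇒x≢0 {x} {y} xy≢0 x≡0 = xy≢0 (trans (cong (_* y) x≡0) (zeroˡ y))

  x*y≢0⇒y≢0 : ∀ {x y} → x * y ≢ 0# → y ≢ 0#
  x*y≢0⇒y≢0 {x} {y} xy≢0 y≡0 = xy≢0 (trans (cong (x *_) y≡0) (zeroʳ x))

  *-cancelˡ : ∀ {a x y} → a ≢ 0# → a * x ≡ a * y → x ≡ y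
  *-cancelˡ {a} {x} {y} a≢0 ax≡ay with x*y≡0⇒x≡0⊎y≡0 (trans (x[y-z]≈xy-xz a x y) (x≡y⇒x-y≡0 ax≡ay))
  ... | inj₁ a≡0   = contradiction a≡0 a≢0
  ... | inj₂ x-y≡0 = x-y≡0⇒x≡y x-y≡0

  *-cancelʳ : ∀ {a x y} → a ≢ 0# → x * a ≡ y * a → x ≡ y
  *-cancelʳ {a} {x} {y} a≢0 xa≡ya = *-cancelˡ a≢0 (trans (*-comm a x) (trans xa≡ya (*-comm y a)))

  prod-≢0⇒∈-≢0 : ∀ {x xs} → prod xs ≢ 0# → x ∈ xs → x ≢ 0#
  prod-≢0⇒∈-≢0 xs≢0 (here refl) = x*y≢0⇒x≢0 xs≢0
  prod-≢0⇒∈-≢0 xs≢0 (there x∈) = prod-≢0⇒∈-≢0 (x*y≢0⇒y≢0 xs≢0) x∈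

  prod-map-allFin≢0 : ∀ {n} (f : Fin n → Carrier) → prod (map f (allFin n)) ≢ 0# → ∀ i → f i ≢ 0#
  prod-map-allFin≢0 f prod≢0 i = prod-≢0⇒∈-≢0 prod≢0 (∈-map⁺ f (∈-allFin i))

  module _ {n} (w : Fin n → Carrier)
    (prod≢0 : prod (concatMap (λ i → map (λ j → w i - w j) (filterᵇ (λ j → toℕ i ℕ.<ᵇ toℕ j) (allFin n)))
                              (allFin n)) ≢ 0#) where

    prod-differences≢0⇒difference≢0 : ∀ {i j} → toℕ i < toℕ j → w i - w j ≢ 0#
    prod-differences≢0⇒difference≢0 {i} {j} i<j = prod-≢0⇒∈-≢0 prod≢0
      (∈-concatMap⁺ _ (lose (∈-allFin i)
        (∈-map⁺ (λ j → w i - w j) (∈-filter⁺ (λ j → T? (toℕ i ℕ.<ᵇ toℕ j)) (∈-allFin j) (ℕP.<⇒<ᵇ i<j)))))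

    prod-differences≢0⇒injective : Injective _≡_ _≡_ w
    prod-differences≢0⇒injective {i} {j} wᵢ≡wⱼ with <-cmp i j
    ... | tri< i<j _ _ = contradiction (x≡y⇒x-y≡0 wᵢ≡wⱼ) (prod-differences≢0⇒difference≢0 i<j)
    ... | tri≈ _ i≡j _ = i≡j
    ... | tri> _ _ j<i = contradiction (x≡y⇒x-y≡0 (sym wᵢ≡wⱼ)) (prod-differences≢0⇒difference≢0 j<i)

  infix 30 _²
  _² : Carrier → Carrier
  x ² = x * x

  ²-≢0 : ∀ {x} → x ≢ 0# → x ² ≢ 0#
  ²-≢0 x≢0 = x*y≢0 x≢0 x≢0

  *-² : ∀ x y → (x * y) ² ≡ x ² * y ²
  *-² x y = interchange x y x y

  *-cancelˡ-² : ∀ {a x y} → a ≢ 0# → (a * x) ² ≡ (a * y) ² → x ² ≡ y ²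
  *-cancelˡ-² {a} {x} {y} a≢0 eq = *-cancelˡ (²-≢0 a≢0) (trans (sym (*-² a x)) (trans eq (*-² a y)))

  signF-² : ∀ s → signF s ² ≡ 1#
  signF-² Sign.+ = *-identityˡ 1#
  signF-² Sign.- = trans (sym (-‿distribˡ-* 1# (- 1#)))
                     (trans (cong -_ (*-identityˡ (- 1#))) (-‿involutive 1#))

  signF*-² : ∀ s x → (signF s * x) ² ≡ x ²
  signF*-² s x = trans (*-² (signF s) x) (trans (cong (_* x ²) (signF-² s)) (*-identityˡ (x ²)))

  signF*x*y≡z⇒[xy]²≡z² : ∀ s {x y z} → signF s * x * y ≡ z → (x * y) ² ≡ z ²
  signF*x*y≡z⇒[xy]²≡z² s {x} {y} eq =
    trans (sym (signF*-² s (x * y))) (cong _² (trans (sym (*-assoc (signF s) x y)) eq))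

  ^-+ : ∀ x m n → x ^ (m ℕ.+ n) ≡ x ^ m * x ^ n
  ^-+ x zero    n = sym (*-identityˡ _)
  ^-+ x (suc m) n = trans (cong (x *_) (^-+ x m n)) (sym (*-assoc x _ _))

  ^-≢0 : ∀ {x} n → x ≢ 0# → x ^ n ≢ 0#
  ^-≢0 zero    _   = 1≢0
  ^-≢0 (suc n) x≢0 = x*y≢0 x≢0 (^-≢0 n x≢0)

  ^-double : ∀ x n → x ^ (2 ℕ.* n) ≡ (x ^ n) ²
  ^-double x n = trans (cong (λ m → x ^ (n ℕ.+ m)) (ℕP.+-identityʳ n)) (^-+ x n n)

  ^-*-≡1 : ∀ {x} d c → x ^ d ≡ 1# → x ^ (c ℕ.* d) ≡ 1#
  ^-*-≡1     d zero    _     = refl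
  ^-*-≡1 {x} d (suc c) xᵈ≡1 =
    trans (^-+ x d (c ℕ.* d)) (trans (cong₂ _*_ xᵈ≡1 (^-*-≡1 d c xᵈ≡1)) (*-identityˡ 1#))

  ^-% : ∀ {x} d .{{_ : ℕ.NonZero d}} → x ^ d ≡ 1# → ∀ j → x ^ j ≡ x ^ (j % d)
  ^-% {x} d xᵈ≡1 j = begin
    x ^ j                                ≡⟨ cong (x ^_) (m≡m%n+[m/n]*n j d) ⟩
    x ^ (j % d ℕ.+ (j / d) ℕ.* d)        ≡⟨ ^-+ x (j % d) _ ⟩
    x ^ (j % d) * x ^ ((j / d) ℕ.* d)    ≡⟨ cong (x ^ (j % d) *_) (^-*-≡1 d (j / d) xᵈ≡1) ⟩
    x ^ (j % d) * 1#                     ≡⟨ *-identityʳ _ ⟩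
    x ^ (j % d)                          ∎
    where open ≡-Reasoning

  nonzero-injection⇒≤ : ∀ {n d} → Carrier ↔ Fin n → (f : ∀ x → x ≢ 0# → Fin d) →
    (∀ {x y} x≢0 y≢0 → f x x≢0 ≡ f y y≢0 → x ≡ y) → n ∸ 1 ≤ d
  nonzero-injection⇒≤ {zero}  _ _ _     = z≤n
  nonzero-injection⇒≤ {suc n} E f f-inj = injective⇒≤ f∘nonzero-injective
    where
    open Inverse E

    nonzero : Fin n → Carrier
    nonzero c = from (punchIn (to 0#) c)

    nonzero≢0 : ∀ c → nonzero c ≢ 0#
    nonzero≢0 c eq = punchInᵢ≢i (to 0#) c (trans (sym (strictlyInverseˡ _)) (cong to eq))

    f∘nonzero-injective : Injective _≡_ _≡_ (λ c → f (nonzero c) (nonzero≢0 c))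
    f∘nonzero-injective {a} {b} eq =
      punchIn-injective (to 0#) a b (↔-to-injective (↔-sym E) (f-inj _ _ eq))

  nonzero-pigeonhole : ∀ {n} → Carrier ↔ Fin n → (f : Fin n → Carrier) → (∀ i → f i ≢ 0#) →
    ∃₂ λ a b → a Fin.< b × f a ≡ f b
  nonzero-pigeonhole {zero}  E _ _   = ⊥-elim (¬Fin0 (Inverse.to E 0#))
  nonzero-pigeonhole {suc n} E f f≢0 = collision (pigeonhole (ℕP.n<1+n n) (λ i → punchOut (0≢f i)))
    where
    0≢f : ∀ i → Inverse.to E 0# ≢ Inverse.to E (f i)
    0≢f i eq = f≢0 i (↔-to-injective E (sym eq))

    collision : (∃₂ λ a b → a Fin.< b × punchOut (0≢f a) ≡ punchOut (0≢f b)) →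
      ∃₂ λ a b → a Fin.< b × f a ≡ f b
    collision (a , b , a<b , eq) =
      a , b , a<b , ↔-to-injective E (punchOut-injective (0≢f a) (0≢f b) eq)

  invariant-cyclotomic : ∀ g {k} (μ : Carrier → Carrier) → (∀ x → μ (x * g ^ k) ≡ μ x) →
    IsCyclotomicMap g k (λ x → μ x * x)
  invariant-cyclotomic g {k} μ μ-invariant =
    (λ i → μ (g ^ toℕ i)) , zeroʳ _ , λ i t → cong (_* _) (μ-periodic (toℕ i) t)
    where
    μ-periodic : ∀ n t → μ (g ^ (n ℕ.+ t ℕ.* k)) ≡ μ (g ^ n)
    μ-periodic n zero    = cong (μ ∘ (g ^_)) (ℕP.+-identityʳ n)
    μ-periodic n (suc t) = begin
      μ (g ^ (n ℕ.+ (k ℕ.+ t ℕ.* k)))  ≡⟨ cong (μ ∘ (g ^_)) (ℕ+.x∙yz≈xz∙y n k (t ℕ.* k)) ⟩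
      μ (g ^ (n ℕ.+ t ℕ.* k ℕ.+ k))    ≡⟨ cong μ (^-+ g (n ℕ.+ t ℕ.* k) k) ⟩
      μ (g ^ (n ℕ.+ t ℕ.* k) * g ^ k)  ≡⟨ μ-invariant _ ⟩
      μ (g ^ (n ℕ.+ t ℕ.* k))          ≡⟨ μ-periodic n t ⟩
      μ (g ^ n)                        ∎
      where open ≡-Reasoning

  module Generator (g : Carrier) (gen : IsGenerator g) where

    order-minimal : ∀ d → 0 < d → g ^ d ≡ 1# → q ∸ 1 ≤ d
    order-minimal (suc d) _ gᵈ≡1 = nonzero-injection⇒≤ enum residue residue-injective
      where
      residue : ∀ x → x ≢ 0# → Fin (suc d)
      residue x x≢0 = fromℕ< (m%n<n (proj₁ (proj₂ gen x x≢0)) (suc d))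

      g^residue : ∀ x x≢0 → g ^ toℕ (residue x x≢0) ≡ x
      g^residue x x≢0 with proj₂ gen x x≢0
      ... | j , gʲ≡x =
        trans (cong (g ^_) (toℕ-fromℕ< (m%n<n j (suc d)))) (trans (sym (^-% (suc d) gᵈ≡1 j)) gʲ≡x)

      residue-injective : ∀ {x y} x≢0 y≢0 → residue x x≢0 ≡ residue y y≢0 → x ≡ y
      residue-injective x≢0 y≢0 eq =
        trans (sym (g^residue _ x≢0)) (trans (cong (λ i → g ^ toℕ i) eq) (g^residue _ y≢0))

    ^[q∸1]≡1 : g ^ (q ∸ 1) ≡ 1#
    ^[q∸1]≡1 with nonzero-pigeonhole enum (λ i → g ^ toℕ i) (λ i → ^-≢0 (toℕ i) (proj₁ gen))
    ... | a , b , a<b , gᵃ≡gᵇ = subst (λ n → g ^ n ≡ 1#) d≡q∸1 gᵈ≡1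
      where
      d = toℕ b ∸ toℕ a

      gᵈ≡1 : g ^ d ≡ 1#
      gᵈ≡1 = *-cancelˡ (^-≢0 (toℕ a) (proj₁ gen)) (begin
        g ^ toℕ a * g ^ d        ≡⟨ sym (^-+ g (toℕ a) d) ⟩
        g ^ (toℕ a ℕ.+ d)        ≡⟨ cong (g ^_) (ℕP.m+[n∸m]≡n (ℕP.<⇒≤ a<b)) ⟩
        g ^ toℕ b                ≡⟨ sym gᵃ≡gᵇ ⟩
        g ^ toℕ a                ≡⟨ sym (*-identityʳ _) ⟩
        g ^ toℕ a * 1#           ∎)
        where open ≡-Reasoning

      d≡q∸1 : d ≡ q ∸ 1
      d≡q∸1 = ℕP.≤-antisym
        (ℕP.≤-trans (ℕP.m∸n≤m (toℕ b) (toℕ a)) (ℕP.<⇒≤pred (toℕ<n b)))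
        (order-minimal d (ℕP.m<n⇒0<n∸m a<b) gᵈ≡1)

    cyclotomic-shift : ∀ {ℓ θ} → 0 < ℓ → IsCyclotomicMap g ℓ θ →
      ∀ x → x ≢ 0# → θ (x * g ^ ℓ) ≡ θ x * g ^ ℓ
    cyclotomic-shift {suc ℓ′} {θ} _ (a , _ , θ-cyclotomic) x x≢0 with proj₂ gen x x≢0
    ... | j , gʲ≡x = begin
      θ (x * g ^ ℓ)                  ≡⟨ cong θ x*gˡ≡ ⟩
      θ (g ^ (i ℕ.+ suc t ℕ.* ℓ))    ≡⟨ θ-cyclotomic r (suc t) ⟩
      a r * g ^ (i ℕ.+ suc t ℕ.* ℓ)  ≡⟨ cong (a r *_) (sym x*gˡ≡) ⟩
      a r * (x * g ^ ℓ)              ≡⟨ sym (*-assoc (a r) x _) ⟩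
      a r * x * g ^ ℓ                ≡⟨ cong (_* g ^ ℓ) (sym θx≡) ⟩
      θ x * g ^ ℓ                    ∎
      where
      open ≡-Reasoning
      ℓ = suc ℓ′
      r = fromℕ< (m%n<n j ℓ)
      i = toℕ r
      t = j / ℓ

      x≡ : g ^ (i ℕ.+ t ℕ.* ℓ) ≡ x
      x≡ = trans (cong (λ n → g ^ (n ℕ.+ t ℕ.* ℓ)) (toℕ-fromℕ< (m%n<n j ℓ)))
                 (trans (cong (g ^_) (sym (m≡m%n+[m/n]*n j ℓ))) gʲ≡x)

      θx≡ : θ x ≡ a r * x
      θx≡ = subst (λ x → θ x ≡ a r * x) x≡ (θ-cyclotomic r t)

      x*gˡ≡ : x * g ^ ℓ ≡ g ^ (i ℕ.+ suc t ℕ.* ℓ)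
      x*gˡ≡ = begin
        x * g ^ ℓ                         ≡⟨ cong (_* g ^ ℓ) (sym x≡) ⟩
        g ^ (i ℕ.+ t ℕ.* ℓ) * g ^ ℓ       ≡⟨ sym (^-+ g (i ℕ.+ t ℕ.* ℓ) ℓ) ⟩
        g ^ (i ℕ.+ t ℕ.* ℓ ℕ.+ ℓ)         ≡⟨ cong (g ^_) (ℕ+.xy∙z≈x∙zy i (t ℕ.* ℓ) ℓ) ⟩
        g ^ (i ℕ.+ suc t ℕ.* ℓ)           ∎

  module ClassMap {h} (v : Fin h → Carrier) (v≢0 : ∀ i → v i ≢ 0#)
                  (v²-injective : Injective _≡_ _≡_ (λ i → v i ²)) where

    InClass : Carrier → Set
    InClass x = ∃ λ i → x ² ≡ v i ²

    class? : ∀ x → Dec (InClass x)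
    class? x = any? (λ i → x ² ≟ v i ²)

    multiplier : (Fin h → Carrier) → Carrier → Carrier → Carrier
    multiplier M R x = lookupOr _≟_ (λ i → v i ²) M R (x ²)

    classMap : (Fin h → Carrier) → Carrier → Carrier → Carrier
    classMap M R x = multiplier M R x * x

    multiplier-class : ∀ M R {x i} → x ² ≡ v i ² → multiplier M R x ≡ M i
    multiplier-class M R {i = i} x²≡ =
      trans (cong (lookupOr _≟_ (λ i → v i ²) M R) x²≡) (lookupOr-key _≟_ _ v²-injective M R i)

    multiplier-default : ∀ M R {x} → ¬ InClass x → multiplier M R x ≡ R
    multiplier-default M R = lookupOr-default _≟_ _ M R

    multiplier-unit : ∀ M R {u} x → u ² ≡ 1# → multiplier M R (x * u) ≡ multiplier M R x
    multiplier-unit M R {u} x u²≡1 =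
      cong (lookupOr _≟_ (λ i → v i ²) M R) (trans (*-² x u) (trans (cong (x ² *_) u²≡1) (*-identityʳ _)))

    multiplier⁻¹ : ∀ {M R i x} → (∀ j → M j ≡ M i → j ≡ i) → M i ≢ R →
      multiplier M R x ≡ M i → x ² ≡ v i ²
    multiplier⁻¹ {M} {R} {i} {x} Mᵢ-unique Mᵢ≢R eq with class? x
    ... | yes (j , x²≡) =
      subst (λ j → x ² ≡ v j ²) (Mᵢ-unique j (trans (sym (multiplier-class M R x²≡)) eq)) x²≡
    ... | no x∉        = contradiction (trans (sym eq) (multiplier-default M R x∉)) Mᵢ≢R

    classMap-sub : ∀ M R x → classMap M R x - x ≡ classMap (λ i → M i - 1#) (R - 1#) x
    classMap-sub M R x = sym (begin
      multiplier (λ i → M i - 1#) (R - 1#) x * x  ≡⟨ cong (_* x) (lookupOr-map _≟_ _ (_- 1#) M R (x ²)) ⟩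
      (multiplier M R x - 1#) * x                ≡⟨ [y-z]x≈yx-zx x _ 1# ⟩
      classMap M R x - 1# * x                    ≡⟨ cong (λ y → classMap M R x - y) (*-identityˡ x) ⟩
      classMap M R x - x                         ∎)
      where open ≡-Reasoning

    classMap-default : ∀ {M R x} → ¬ InClass x → classMap M R x ≡ R * x
    classMap-default {M} {R} x∉ = cong (_* _) (multiplier-default M R x∉)

    module _ {M : Fin h → Carrier} {R : Carrier} {π : Fin h → Fin h}
             (R≢0 : R ≢ 0#) (π-injective : Injective _≡_ _≡_ π)
             (M-permutes : ∀ i → (M i * v i) ² ≡ (R * v (π i)) ²) where

      classMap-class² : ∀ {x i} → x ² ≡ v i ² → classMap M R x ² ≡ (R * v (π i)) ²
      classMap-class² {x} {i} x²≡ = begin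
        (multiplier M R x * x) ²    ≡⟨ cong (λ μ → (μ * x) ²) (multiplier-class M R x²≡) ⟩
        (M i * x) ²                 ≡⟨ *-² (M i) x ⟩
        M i ² * x ²                 ≡⟨ cong (M i ² *_) x²≡ ⟩
        M i ² * v i ²               ≡⟨ sym (*-² (M i) (v i)) ⟩
        (M i * v i) ²               ≡⟨ M-permutes i ⟩
        (R * v (π i)) ²             ∎
        where open ≡-Reasoning

      classMap-class≢default : ∀ {x y i} → x ² ≡ v i ² → ¬ InClass y → classMap M R x ≢ classMap M R y
      classMap-class≢default {x} {y} {i} x²≡ y∉ eq = y∉ (π i , *-cancelˡ-² R≢0 (begin
        (R * y) ²               ≡⟨ cong _² (sym (classMap-default y∉)) ⟩
        classMap M R y ²        ≡⟨ cong _² (sym eq) ⟩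
        classMap M R x ²        ≡⟨ classMap-class² x²≡ ⟩
        (R * v (π i)) ²         ∎))
        where open ≡-Reasoning

      M≢0 : ∀ i → M i ≢ 0#
      M≢0 i Mᵢ≡0 = ²-≢0 (x*y≢0 R≢0 (v≢0 (π i))) (begin
        (R * v (π i)) ²  ≡⟨ sym (M-permutes i) ⟩
        (M i * v i) ²    ≡⟨ cong (λ μ → (μ * v i) ²) Mᵢ≡0 ⟩
        (0# * v i) ²     ≡⟨ cong _² (zeroˡ (v i)) ⟩
        0# ²             ≡⟨ zeroˡ 0# ⟩
        0#               ∎)
        where open ≡-Reasoning

      classMap-injective : Injective _≡_ _≡_ (classMap M R)
      classMap-injective {x} {y} eq with class? x | class? y
      ... | yes (i , x²≡) | yes (j , y²≡) = *-cancelˡ (M≢0 i) (begin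
          M i * x          ≡⟨ cong (_* x) (sym (multiplier-class M R x²≡)) ⟩
          classMap M R x   ≡⟨ eq ⟩
          classMap M R y   ≡⟨ cong (_* y) (multiplier-class M R y²≡′) ⟩
          M i * y          ∎)
        where
        open ≡-Reasoning
        i≡j : i ≡ j
        i≡j = π-injective (v²-injective (*-cancelˡ-² R≢0
          (trans (sym (classMap-class² x²≡)) (trans (cong _² eq) (classMap-class² y²≡)))))
        y²≡′ : y ² ≡ v i ²
        y²≡′ = subst (λ k → y ² ≡ v k ²) (sym i≡j) y²≡
      ... | yes (i , x²≡) | no y∉ = contradiction eq (classMap-class≢default x²≡ y∉)
      ... | no x∉ | yes (j , y²≡) = contradiction (sym eq) (classMap-class≢default y²≡ x∉)
      ... | no x∉ | no y∉ =
        *-cancelˡ R≢0 (trans (sym (classMap-default x∉)) (trans eq (classMap-default y∉)))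

    module _ {M : Fin h → Carrier} {R : Carrier} {π π′ : Fin h → Fin h}
             (R≢0 : R ≢ 0#) (R-1≢0 : R - 1# ≢ 0#)
             (π-injective : Injective _≡_ _≡_ π) (π′-injective : Injective _≡_ _≡_ π′)
             (M-permutes : ∀ i → (M i * v i) ² ≡ (R * v (π i)) ²)
             (M-1-permutes : ∀ i → ((M i - 1#) * v i) ² ≡ ((R - 1#) * v (π′ i)) ²) where

      classMap-orthomorphism : IsOrthomorphism (classMap M R)
      classMap-orthomorphism =
        bijective (classMap-injective R≢0 π-injective M-permutes) , bijective classMap-sub-injective
        where
        bijective : ∀ {f} → Injective _≡_ _≡_ f → Bijective _≡_ _≡_ f
        bijective f-injective = f-injective , ↔Fin-injective⇒surjective enum f-injective

        classMap-sub-injective : Injective _≡_ _≡_ (λ x → classMap M R x - x)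
        classMap-sub-injective {x} {y} eq = classMap-injective R-1≢0 π′-injective M-1-permutes
          (trans (sym (classMap-sub M R x)) (trans eq (classMap-sub M R y)))

    module _ (g : Carrier) (gen : IsGenerator g) where
      open Generator g gen

      classMap-cyclotomic : ∀ M R {k} → q ∸ 1 ≡ 2 ℕ.* k → IsCyclotomicMap g k (classMap M R)
      classMap-cyclotomic M R {k} q∸1≡2k =
        invariant-cyclotomic g (multiplier M R) (λ x → multiplier-unit M R x gᵏ²≡1)
        where
        gᵏ²≡1 : (g ^ k) ² ≡ 1#
        gᵏ²≡1 = trans (sym (^-double g k)) (subst (λ n → g ^ n ≡ 1#) q∸1≡2k ^[q∸1]≡1)

      classMap-least-index : ∀ {M R i k} → (∀ j → M j ≡ M i → j ≡ i) → M i ≢ R → q ∸ 1 ≡ 2 ℕ.* k →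
        ∀ ℓ → ℓ < k → ℓ ℕD.∣ (q ∸ 1) → ¬ InC g ℓ (classMap M R)
      classMap-least-index _ _ q∸1≡2k zero (ℕ.s≤s z≤n) 0∣q∸1 _ =
        contradiction (trans (sym q∸1≡2k) (ℕD.0∣⇒≡0 0∣q∸1)) λ ()
      classMap-least-index {M} {R} {i} Mᵢ-unique Mᵢ≢R q∸1≡2k ℓ@(suc _) ℓ<k _ (_ , _ , cyclotomic) =
        ℕP.<⇒≱ 2ℓ<q∸1 (order-minimal (2 ℕ.* ℓ) (ℕ.s≤s z≤n) g²ˡ≡1)
        where
        open ≡-Reasoning
        x = v i * g ^ ℓ

        x≢0 : x ≢ 0#
        x≢0 = x*y≢0 (v≢0 i) (^-≢0 ℓ (proj₁ gen))

        multiplier≡Mᵢ : multiplier M R x ≡ M i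
        multiplier≡Mᵢ = *-cancelʳ x≢0 (begin
          classMap M R x
            ≡⟨ cyclotomic-shift {θ = classMap M R} (ℕ.s≤s z≤n) cyclotomic (v i) (v≢0 i) ⟩
          classMap M R (v i) * g ^ ℓ   ≡⟨ cong (λ μ → μ * v i * g ^ ℓ) (multiplier-class M R refl) ⟩
          M i * v i * g ^ ℓ            ≡⟨ *-assoc (M i) (v i) (g ^ ℓ) ⟩
          M i * x                      ∎)

        g²ˡ≡1 : g ^ (2 ℕ.* ℓ) ≡ 1#
        g²ˡ≡1 = trans (^-double g ℓ) (*-cancelˡ (²-≢0 (v≢0 i)) (begin
          v i ² * (g ^ ℓ) ²  ≡⟨ sym (*-² (v i) (g ^ ℓ)) ⟩
          x ²                ≡⟨ multiplier⁻¹ Mᵢ-unique Mᵢ≢R multiplier≡Mᵢ ⟩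
          v i ²              ≡⟨ sym (*-identityʳ (v i ²)) ⟩
          v i ² * 1#         ∎))

        2ℓ<q∸1 : 2 ℕ.* ℓ < q ∸ 1
        2ℓ<q∸1 = subst (2 ℕ.* ℓ <_) (sym q∸1≡2k) (ℕP.*-monoʳ-< 2 ℓ<k)

odd⇒2∣pred : ∀ q → q % 2 ≡ 1 → 2 ℕD.∣ q ∸ 1
odd⇒2∣pred q q-odd =
  ℕD.divides (q / 2) (cong (_∸ 1) (trans (m≡m%n+[m/n]*n q 2) (cong (ℕ._+ (q / 2) ℕ.* 2) q-odd)))

lemma3p2 : (q : ℕ) (F : FiniteField q) → IsPrimePower q → q % 2 ≡ 1 →
  let open FiniteField F in
  (g : Carrier) → IsGenerator g →
  (h′ : ℕ) → let h = ℕ.suc h′ in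
  (ρ τ : Permutation′ h) (σ : Fin h → Sign)
  (r : Carrier) (m v : Fin h → Carrier) →
  r ≢ 0# → (∀ i → m i ≢ 0#) → (∀ i → v i ≢ 0#) →
  (∀ i → signF (σ i) * m i * v i ≡ r * v (ρ ⟨$⟩ʳ i)) →
  (∀ i → (m i - 1#) * v i ≡ (r - 1#) * v (τ ⟨$⟩ʳ i)) →
  (m zero - r)
    * prod (map (λ i → m zero - m (suc i)) (allFin h′))
    * prod (concatMap (λ i → map (λ j → v i * v i - v j * v j)
                                 (filterᵇ (λ j → toℕ i ℕ.<ᵇ toℕ j) (allFin h)))
                      (allFin h))
    ≢ 0# →
  Σ (Carrier → Carrier) λ φ → InD g ((q ∸ 1) / 2) φ
lemma3p2 q F _ q-odd g gen h′ ρ τ σ r m v r≢0 _ v≢0 hρ hτ nondegenerate =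
  classMap m r ,
  ( (ℕD.divides 2 q∸1≡2K , orthomorphism , classMap-cyclotomic g gen m r q∸1≡2K)
  , classMap-least-index g gen m₀-unique m₀≢r q∸1≡2K )
  where
  open FiniteField F
  open FieldProperties F
  open IsCommutativeRing isCommutativeRing using (zeroˡ)
  open ClassMap v v≢0 (prod-differences≢0⇒injective (λ i → v i ²) (x*y≢0⇒y≢0 nondegenerate))

  q∸1≡2K : q ∸ 1 ≡ 2 ℕ.* ((q ∸ 1) / 2)
  q∸1≡2K = sym (m*[n/m]≡n (odd⇒2∣pred q q-odd))

  m₀≢r : m zero ≢ r
  m₀≢r m₀≡r = x*y≢0⇒x≢0 (x*y≢0⇒x≢0 nondegenerate) (x≡y⇒x-y≡0 m₀≡r)

  m₀-unique : ∀ j → m j ≡ m zero → j ≡ zero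
  m₀-unique zero    _      = refl
  m₀-unique (suc k) mₖ≡m₀ = contradiction (x≡y⇒x-y≡0 (sym mₖ≡m₀))
    (prod-map-allFin≢0 (λ k → m zero - m (suc k)) (x*y≢0⇒y≢0 (x*y≢0⇒x≢0 nondegenerate)) k)

  r-1≢0 : r - 1# ≢ 0#
  r-1≢0 r-1≡0 with x*y≡0⇒x≡0⊎y≡0 (trans (hτ zero) (trans (cong (_* _) r-1≡0) (zeroˡ _)))
  ... | inj₁ m₀-1≡0 = m₀≢r (trans (x-y≡0⇒x≡y m₀-1≡0) (sym (x-y≡0⇒x≡y r-1≡0)))
  ... | inj₂ v₀≡0   = v≢0 zero v₀≡0

  orthomorphism : IsOrthomorphism (classMap m r)
  orthomorphism = classMap-orthomorphism r≢0 r-1≢0 (↔-to-injective ρ) (↔-to-injective τ)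
    (λ i → signF*x*y≡z⇒[xy]²≡z² (σ i) (hρ i)) (λ i → cong _² (hτ i))
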